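{- The stack sorting operator $\mathbf{S}$ is $\mathsf{TOTO}$-definable: there is a $\mathsf{TOTO}$ formula $\phi(x,y)$ such that for every permutation $\sigma$ and all elements $a,b$ of $\sigma$, $(\sigma,a,b)\models\phi(x,y)$ if and only if $a$ precedes $b$ in $\mathbf{S}(\sigma)$.
   Context: A permutation $\sigma$ of size $n$ is identified with the finite structure whose domain is $A^\sigma=\{(i,\sigma(i)) : 1\le i\le n\}$, equipped with the position order $<_P$ (comparing first coordinates) and the value order $<_V$ (comparing second coordinates). $\mathsf{TOTO}$ is first-order logic (with equality) over the signature of two binary relation symbols $<_P,<_V$ interpreted in this way. The stack sorting operator $\mathbf{S}$ processes the one-line notation of $\sigma$ from left to right using a stack whose contents are always increasing from top to bottom: when an entry is processed, entries are popped from the top of the stack to the output while the top of the stack is smaller than the new entry, and then the new entry is pushed; when the input is exhausted the stack is emptied to the output. $\mathbf{S}(\sigma)$ is the resulting output word (a permutation of the same values); elements of $\sigma$ are identified with their values, so "$a$ precedes $b$ in $\mathbf{S}(\sigma)$" compares the positions of the values of $a$ and $b$ in $\mathbf{S}(\sigma)$. -}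

module Defs where

open import Data.Nat using (ℕ; _<ᵇ_)
open import Data.Bool using (if_then_else_)
open import Data.Fin using (Fin; toℕ; zero; suc) renaming (_<_ to _<ᶠ_)
open import Data.Fin.Permutation using (Permutation′; _⟨$⟩ʳ_)
open import Data.List using (List; []; _∷_; _++_; map)
open import Data.List.Base using (tabulate)
open import Data.Product using (_×_; _,_; Σ; ∃)
open import Data.Sum using (_⊎_)
open import Data.Empty using (⊥)
open import Relation.Binary.PropositionalEquality using (_≡_)

-- Syntax of TOTO: first-order logic with equality over {<_P, <_V}.
-- Variables are de Bruijn indices: a formula with k free variables.

data Formula (k : ℕ) : Set where
  _≐_  : Fin k → Fin k → Formula k
  _<P_ : Fin k → Fin k → Formula k
  _<V_ : Fin k → Fin k → Formula k
  ⊥ᶠ   : Formula k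
  ¬ᶠ_  : Formula k → Formula k
  _∧ᶠ_ : Formula k → Formula k → Formula k
  _∨ᶠ_ : Formula k → Formula k → Formula k
  _⇒ᶠ_ : Formula k → Formula k → Formula k
  ∀ᶠ   : Formula (ℕ.suc k) → Formula k
  ∃ᶠ   : Formula (ℕ.suc k) → Formula k

_▸_ : ∀ {k} {A : Set} → (Fin k → A) → A → Fin (ℕ.suc k) → A
(ρ ▸ a) zero    = a
(ρ ▸ a) (suc i) = ρ i

-- Semantics. The permutation σ of size n is the structure with domain
-- Fin n (element i stands for the point (i, σ(i))), with
--   i <_P j  iff  i < j     and     i <_V j  iff  σ(i) < σ(j).

Sat : ∀ {n k} → Permutation′ n → Formula k → (Fin k → Fin n) → Set
Sat σ (x ≐ y)  ρ = ρ x ≡ ρ y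
Sat σ (x <P y) ρ = ρ x <ᶠ ρ y
Sat σ (x <V y) ρ = (σ ⟨$⟩ʳ ρ x) <ᶠ (σ ⟨$⟩ʳ ρ y)
Sat σ ⊥ᶠ       ρ = ⊥
Sat σ (¬ᶠ φ)   ρ = Sat σ φ ρ → ⊥
Sat σ (φ ∧ᶠ ψ) ρ = Sat σ φ ρ × Sat σ ψ ρ
Sat σ (φ ∨ᶠ ψ) ρ = Sat σ φ ρ ⊎ Sat σ ψ ρ
Sat σ (φ ⇒ᶠ ψ) ρ = Sat σ φ ρ → Sat σ ψ ρ
Sat {n} σ (∀ᶠ φ) ρ = (a : Fin n) → Sat σ φ (ρ ▸ a)
Sat {n} σ (∃ᶠ φ) ρ = Σ (Fin n) (λ a → Sat σ φ (ρ ▸ a))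

env₂ : ∀ {n} → Fin n → Fin n → Fin 2 → Fin n
env₂ a b zero       = a
env₂ a b (suc zero) = b

-- Stack sorting on words (lists of values). The stack is a list whose
-- head is the top of the stack.

popLess : ℕ → List ℕ → List ℕ × List ℕ
popLess x [] = [] , []
popLess x (t ∷ s) with t <ᵇ x
... | Data.Bool.true  with popLess x s
...   | out , rest = t ∷ out , rest
popLess x (t ∷ s) | Data.Bool.false = [] , t ∷ s

stackGo : List ℕ → List ℕ → List ℕ
stackGo []       s = s
stackGo (x ∷ xs) s with popLess x s
... | out , rest = out ++ stackGo xs (x ∷ rest)

stackSortWord : List ℕ → List ℕ
stackSortWord w = stackGo w []

oneLine : ∀ {n} → Permutation′ n → List ℕ
oneLine {n} σ = tabulate {n = n} (λ i → toℕ (σ ⟨$⟩ʳ i))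

stackSort : ∀ {n} → Permutation′ n → List ℕ
stackSort σ = stackSortWord (oneLine σ)

PrecedesIn : ℕ → ℕ → List ℕ → Set
PrecedesIn u v w =
  Σ (List ℕ) λ l₁ → Σ (List ℕ) λ l₂ → Σ (List ℕ) λ l₃ →
    w ≡ l₁ ++ (u ∷ l₂ ++ (v ∷ l₃))

-- element a precedes element b in S(σ) (elements identified with values)
PrecedesInS : ∀ {n} → Permutation′ n → Fin n → Fin n → Set
PrecedesInS σ a b = PrecedesIn (toℕ (σ ⟨$⟩ʳ a)) (toℕ (σ ⟨$⟩ʳ b)) (stackSort σ)

-- If m is the largest entry of a word L m R, then S(L m R) = S(L) S(R) m:
-- when m arrives it pops everything that L left on the stack, and afterwards
-- it sits at the bottom of the stack until the input is exhausted. Induction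
-- along this decomposition shows that a precedes b in S(σ) exactly when
--   a is left of b, and a < b or some entry strictly between them exceeds a; or
--   a is right of b, a < b, and no entry strictly between them exceeds b,
-- a condition written directly with <_P and <_V. For the converse, S(σ) has
-- distinct entries, so precedence in it is asymmetric, while any two distinct
-- entries satisfy the condition in one order or the other.

module Submission where

open import Defs
open import Data.Bool using (true; false; T)
open import Data.Unit using (tt)
open import Data.Empty using (⊥-elim)
open import Data.Nat using (ℕ; zero; suc; _+_; _<_; _≤_; _<ᵇ_; z<s; _<?_; _≟_)
open import Data.Nat.Properties
  using ( <-asym; <ᵇ⇒<; <⇒<ᵇ; <-irrefl; <-trans; <-≤-trans; ≤-trans; <⇒≤; <⇒≢; >⇒≢
        ; ≤∧≢⇒<; ≮⇒≥; <-cmp; ≤-totalOrder; m≤m+n; m<n+m; m≤n⇒∃[o]m+o≡n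
        ; +-monoʳ-<; +-cancelˡ-<; +-cancelˡ-≡; anyUpTo? )
open import Data.Nat.Induction using (<-wellFounded)
open import Induction.WellFounded using (Acc; acc)
open import Data.Fin using (Fin; toℕ; fromℕ<; zero; suc)
open import Data.Fin.Properties using (toℕ<n; toℕ-fromℕ<; fromℕ<-toℕ; toℕ-injective)
open import Data.Fin.Permutation using (Permutation′; _⟨$⟩ʳ_)
open import Data.List using ([]; _∷_; _++_; [_]; applyUpTo; upTo; tabulate)
open import Data.List.Properties using (++-assoc; ++-identityʳ; ∷-injective; tabulate-cong)
open import Data.List.Membership.Propositional using (_∈_; _∉_)
open import Data.List.Membership.Propositional.Properties
  using (∈-∃++; ∈-++⁺ˡ; ∈-++⁺ʳ; ∈-applyUpTo⁺; ∈-upTo⁺; ∈-upTo⁻)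
open import Data.List.Relation.Unary.Any using (here; there)
import Data.List.Relation.Unary.All as All
open import Data.List.Relation.Unary.All using (All; []; _∷_)
open import Data.List.Relation.Unary.All.Properties using (++⁻ʳ; applyUpTo⁺₁)
open import Data.List.Relation.Unary.Unique.Propositional using (Unique; _∷_)
open import Data.List.Relation.Unary.Unique.Propositional.Properties using (Unique[x∷xs]⇒x∉xs)
import Data.List.Relation.Unary.Unique.Setoid.Properties as UniqueS
open import Data.List.Relation.Binary.Permutation.Propositional
  using (_↭_; ↭-refl; ↭-sym; ↭⇒↭ₛ; module PermutationReasoning)
open import Data.List.Relation.Binary.Permutation.Propositional.Properties
  using (shift; shifts; ++⁺ˡ; ∈-resp-↭)
import Data.List.Relation.Binary.Permutation.Setoid.Properties as PermutationS
open import Data.List.Extrema ≤-totalOrder using (argmax; argmax-sel; f[xs]≤f[argmax])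
open import Data.Product using (Σ; _×_; _,_; proj₁; proj₂; ∃-syntax)
open import Data.Sum using (_⊎_; inj₁; inj₂; swap)
open import Function using (_∘_)
open import Function.Bundles using (_⇔_; mk⇔; Equivalence; Injection)
open import Function.Definitions using (Injective)
open import Function.Properties.Inverse using (↔⇒↣)
open import Function.Properties.Equivalence using (⇔-isEquivalence) renaming (trans to ⇔-trans)
open import Relation.Binary.Structures using (IsEquivalence)
open import Relation.Binary.Definitions using (tri<; tri≈; tri>)
open import Relation.Nullary using (¬_; yes; no)
open import Relation.Nullary.Decidable using (_×-dec_)
open import Relation.Binary.PropositionalEquality
  using (_≡_; _≢_; refl; sym; trans; cong; cong₂; subst; setoid; module ≡-Reasoning)

popLess-++ : ∀ x s → proj₁ (popLess x s) ++ proj₂ (popLess x s) ≡ s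
popLess-++ x [] = refl
popLess-++ x (t ∷ s) with t <ᵇ x
... | true with popLess x s | popLess-++ x s
...   | out , rest | eq = cong (t ∷_) eq
popLess-++ x (t ∷ s) | false = refl

popLess-all : ∀ x s → All (_< x) s → popLess x s ≡ (s , [])
popLess-all x [] [] = refl
popLess-all x (t ∷ s) (t<x ∷ s<x) with t <ᵇ x in eq
... | true rewrite popLess-all x s s<x = refl
... | false = ⊥-elim (subst T eq (<⇒<ᵇ t<x))

popLess-blocked : ∀ x r t s → x < t →
  popLess x (r ++ t ∷ s) ≡ (proj₁ (popLess x r) , proj₂ (popLess x r) ++ t ∷ s)
popLess-blocked x [] t s x<t with t <ᵇ x in eq
... | true = ⊥-elim (<-asym x<t (<ᵇ⇒< t x (subst T (sym eq) tt)))
... | false = refl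
popLess-blocked x (u ∷ r) t s x<t with u <ᵇ x
... | true rewrite popLess-blocked x r t s x<t = refl
... | false = refl

stackGo-∷ : ∀ x xs s →
  stackGo (x ∷ xs) s ≡ proj₁ (popLess x s) ++ stackGo xs (x ∷ proj₂ (popLess x s))
stackGo-∷ x xs s with popLess x s
... | out , rest = refl

stackGo-↭ : ∀ xs s → stackGo xs s ↭ xs ++ s
stackGo-↭ [] s = ↭-refl
stackGo-↭ (x ∷ xs) s rewrite stackGo-∷ x xs s =
  subst (λ s′ → out ++ stackGo xs (x ∷ rest) ↭ x ∷ xs ++ s′) (popLess-++ x s) (begin
    out ++ stackGo xs (x ∷ rest)  ↭⟨ ++⁺ˡ out (stackGo-↭ xs (x ∷ rest)) ⟩
    out ++ xs ++ x ∷ rest         ↭⟨ shifts out xs ⟩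
    xs ++ out ++ x ∷ rest         ↭⟨ ++⁺ˡ xs (shift x out rest) ⟩
    xs ++ x ∷ out ++ rest         ↭⟨ shift x xs (out ++ rest) ⟩
    x ∷ xs ++ out ++ rest         ∎)
  where
  open PermutationReasoning
  out = proj₁ (popLess x s)
  rest = proj₂ (popLess x s)

stackSortWord-↭ : ∀ xs → stackSortWord xs ↭ xs
stackSortWord-↭ xs = subst (stackSortWord xs ↭_) (++-identityʳ xs) (stackGo-↭ xs [])

stackGo-above : ∀ xs r t s → All (_< t) xs →
  stackGo xs (r ++ t ∷ s) ≡ stackGo xs r ++ t ∷ s
stackGo-above [] r t s [] = refl
stackGo-above (x ∷ xs) r t s (x<t ∷ xs<t)
  rewrite stackGo-∷ x xs (r ++ t ∷ s) | stackGo-∷ x xs r | popLess-blocked x r t s x<t =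
  begin
    out ++ stackGo xs ((x ∷ rest) ++ t ∷ s)  ≡⟨ cong (out ++_) (stackGo-above xs (x ∷ rest) t s xs<t) ⟩
    out ++ stackGo xs (x ∷ rest) ++ t ∷ s    ≡⟨ ++-assoc out _ _ ⟨
    (out ++ stackGo xs (x ∷ rest)) ++ t ∷ s  ∎
  where
  open ≡-Reasoning
  out = proj₁ (popLess x r)
  rest = proj₂ (popLess x r)

stackGo-max : ∀ m L R s → All (_< m) L → All (_< m) s →
  stackGo (L ++ m ∷ R) s ≡ stackGo L s ++ stackGo R [ m ]
stackGo-max m [] R s [] s<m rewrite stackGo-∷ m R s | popLess-all m s s<m = refl
stackGo-max m (x ∷ L) R s (x<m ∷ L<m) s<m
  rewrite stackGo-∷ x (L ++ m ∷ R) s | stackGo-∷ x L s =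
  begin
    out ++ stackGo (L ++ m ∷ R) (x ∷ rest)           ≡⟨ cong (out ++_) (stackGo-max m L R _ L<m (x<m ∷ rest<m)) ⟩
    out ++ stackGo L (x ∷ rest) ++ stackGo R [ m ]   ≡⟨ ++-assoc out _ _ ⟨
    (out ++ stackGo L (x ∷ rest)) ++ stackGo R [ m ] ∎
  where
  open ≡-Reasoning
  out = proj₁ (popLess x s)
  rest = proj₂ (popLess x s)
  rest<m : All (_< m) rest
  rest<m = ++⁻ʳ out (subst (All (_< m)) (sym (popLess-++ x s)) s<m)

stackSortWord-max : ∀ m L R → All (_< m) L → All (_< m) R →
  stackSortWord (L ++ m ∷ R) ≡ stackSortWord L ++ stackSortWord R ++ [ m ]
stackSortWord-max m L R L<m R<m =
  trans (stackGo-max m L R [] L<m []) (cong (stackSortWord L ++_) (stackGo-above R [] m [] R<m))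

PrecedesIn-++ʳ : ∀ {u v xs} ys → PrecedesIn u v xs → PrecedesIn u v (xs ++ ys)
PrecedesIn-++ʳ {u} {v} ys (l₁ , l₂ , l₃ , refl) = l₁ , l₂ , l₃ ++ ys ,
  trans (++-assoc l₁ (u ∷ l₂ ++ v ∷ l₃) ys) (cong (λ l → l₁ ++ u ∷ l) (++-assoc l₂ (v ∷ l₃) ys))

PrecedesIn-++ˡ : ∀ {u v ys} xs → PrecedesIn u v ys → PrecedesIn u v (xs ++ ys)
PrecedesIn-++ˡ xs (l₁ , l₂ , l₃ , refl) = xs ++ l₁ , l₂ , l₃ , sym (++-assoc xs l₁ _)

PrecedesIn-∈-++ : ∀ {u v xs ys} → u ∈ xs → v ∈ ys → PrecedesIn u v (xs ++ ys)
PrecedesIn-∈-++ {u} u∈xs v∈ys with ∈-∃++ u∈xs | ∈-∃++ v∈ys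
... | l₁ , l₂ , refl | l₃ , l₄ , refl = l₁ , l₂ ++ l₃ , l₄ ,
  trans (++-assoc l₁ (u ∷ l₂) _) (cong (λ l → l₁ ++ u ∷ l) (sym (++-assoc l₂ l₃ _)))

unique-split-∉ : ∀ {u v : ℕ} A B C D → Unique (A ++ u ∷ B) →
  A ++ u ∷ B ≡ C ++ v ∷ D → v ∈ B → u ∉ D
unique-split-∉ [] B [] D u∉B eq v∈B _ with refl , _ ← ∷-injective eq =
  Unique[x∷xs]⇒x∉xs u∉B v∈B
unique-split-∉ [] B (c ∷ C) D u∉B eq _ u∈D with refl , eq′ ← ∷-injective eq =
  Unique[x∷xs]⇒x∉xs u∉B (subst (_ ∈_) (sym eq′) (∈-++⁺ʳ C (there u∈D)))
unique-split-∉ (a ∷ A) B [] D a∉ eq v∈B _ with refl , _ ← ∷-injective eq =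
  Unique[x∷xs]⇒x∉xs a∉ (∈-++⁺ʳ A (there v∈B))
unique-split-∉ (a ∷ A) B (c ∷ C) D (_ ∷ uniq) eq =
  unique-split-∉ A B C D uniq (proj₂ (∷-injective eq))

PrecedesIn-asym : ∀ {u v w} → Unique w → PrecedesIn u v w → ¬ PrecedesIn v u w
PrecedesIn-asym uniq (l₁ , l₂ , l₃ , refl) (m₁ , m₂ , m₃ , eq) =
  unique-split-∉ l₁ (l₂ ++ _ ∷ l₃) m₁ (m₂ ++ _ ∷ m₃) uniq eq
    (∈-++⁺ʳ l₂ (here refl)) (∈-++⁺ʳ m₂ (here refl))

SortsBefore : (ℕ → ℕ) → ℕ → ℕ → Set
SortsBefore g i j =
    (i < j × (g i < g j ⊎ ∃[ k ] (i < k × k < j × g i < g k)))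
  ⊎ (j < i × g i < g j × ¬ (∃[ k ] (j < k × k < i × g j < g k)))

sortsBefore-shift : ∀ g m {i j} → SortsBefore g (m + i) (m + j) → SortsBefore (g ∘ (m +_)) i j
sortsBefore-shift g m (inj₁ (i<j , inj₁ gi<gj)) = inj₁ (+-cancelˡ-< m _ _ i<j , inj₁ gi<gj)
sortsBefore-shift g m {i} (inj₁ (i<j , inj₂ (k , i<k , k<j , gi<gk)))
  with k′ , refl ← m≤n⇒∃[o]m+o≡n (≤-trans (m≤m+n m i) (<⇒≤ i<k)) =
  inj₁ (+-cancelˡ-< m _ _ i<j , inj₂ (k′ , +-cancelˡ-< m _ _ i<k , +-cancelˡ-< m _ _ k<j , gi<gk))
sortsBefore-shift g m (inj₂ (j<i , gi<gj , none)) =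
  inj₂ (+-cancelˡ-< m _ _ j<i , gi<gj ,
        λ (k , j<k , k<i , gj<gk) → none (m + k , +-monoʳ-< m j<k , +-monoʳ-< m k<i , gj<gk))

sortsBefore-connex-< : ∀ {g} → Injective _≡_ _≡_ g → ∀ {i j} → i < j →
  SortsBefore g i j ⊎ SortsBefore g j i
sortsBefore-connex-< {g} g-inj {i} {j} i<j with g i <? g j
... | yes gi<gj = inj₁ (inj₁ (i<j , inj₁ gi<gj))
... | no gi≮gj with anyUpTo? (λ k → (i <? k) ×-dec (g i <? g k)) j
...   | yes (k , k<j , i<k , gi<gk) = inj₁ (inj₁ (i<j , inj₂ (k , i<k , k<j , gi<gk)))
...   | no none = inj₂ (inj₂ (i<j , gj<gi , λ (k , i<k , k<j , gi<gk) → none (k , k<j , i<k , gi<gk)))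
  where
  gj<gi : g j < g i
  gj<gi = ≤∧≢⇒< (≮⇒≥ gi≮gj) (λ gj≡gi → <⇒≢ i<j (g-inj (sym gj≡gi)))

sortsBefore-connex : ∀ {g} → Injective _≡_ _≡_ g → ∀ {i j} → i ≢ j →
  SortsBefore g i j ⊎ SortsBefore g j i
sortsBefore-connex g-inj {i} {j} i≢j with <-cmp i j
... | tri< i<j _ _ = sortsBefore-connex-< g-inj i<j
... | tri≈ _ i≡j _ = ⊥-elim (i≢j i≡j)
... | tri> _ _ j<i = swap (sortsBefore-connex-< g-inj j<i)

applyUpTo-split : ∀ {A : Set} (g : ℕ → A) p b →
  applyUpTo g (suc p + b) ≡ applyUpTo g p ++ g p ∷ applyUpTo (g ∘ (suc p +_)) b
applyUpTo-split g zero b = refl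
applyUpTo-split g (suc p) b = cong (g 0 ∷_) (applyUpTo-split (g ∘ suc) p b)

∃-strict-argmax : ∀ {g} → Injective _≡_ _≡_ g → ∀ {n} → 0 < n →
  ∃[ p ] (p < n × (∀ {k} → k < n → k ≢ p → g k < g p))
∃-strict-argmax {g} g-inj {n} 0<n =
  p , p<n , λ k<n k≢p → ≤∧≢⇒< (All.lookup (f[xs]≤f[argmax] 0 (upTo n)) (∈-upTo⁺ k<n)) (k≢p ∘ g-inj)
  where
  p = argmax g 0 (upTo n)
  p<n : p < n
  p<n with argmax-sel g 0 (upTo n)
  ... | inj₁ p≡0 = subst (_< n) (sym p≡0) 0<n
  ... | inj₂ p∈ = ∈-upTo⁻ p∈

stackSortWord-applyUpTo-max : ∀ g p b → (∀ {k} → k < suc p + b → k ≢ p → g k < g p) →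
  stackSortWord (applyUpTo g (suc p + b))
    ≡ stackSortWord (applyUpTo g p) ++ stackSortWord (applyUpTo (g ∘ (suc p +_)) b) ++ [ g p ]
stackSortWord-applyUpTo-max g p b g<gp =
  trans (cong stackSortWord (applyUpTo-split g p b)) (stackSortWord-max (g p) _ _
    (applyUpTo⁺₁ g p (λ k<p → g<gp (<-trans k<p (m≤m+n (suc p) b)) (<⇒≢ k<p)))
    (applyUpTo⁺₁ (g ∘ (suc p +_)) b (λ {k} k<b → g<gp (+-monoʳ-< (suc p) k<b) (>⇒≢ (m≤m+n (suc p) k)))))

∈-stackSortWord-applyUpTo : ∀ g {n k} → k < n → g k ∈ stackSortWord (applyUpTo g n)
∈-stackSortWord-applyUpTo g k<n = ∈-resp-↭ (↭-sym (stackSortWord-↭ _)) (∈-applyUpTo⁺ g k<n)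

module _ {g : ℕ → ℕ} {p b : ℕ} (g<gp : ∀ {k} → k < suc p + b → k ≢ p → g k < g p) where

  private
    g′ = g ∘ (suc p +_)
    left = stackSortWord (applyUpTo g p)
    right = stackSortWord (applyUpTo g′ b)

  ¬max<g : ∀ {k} → k < suc p + b → ¬ (g p < g k)
  ¬max<g {k} k<n gp<gk with k ≟ p
  ... | yes refl = <-irrefl refl gp<gk
  ... | no k≢p = <-asym gp<gk (g<gp k<n k≢p)

  ¬sortsBefore-max : ∀ {j} → j < suc p + b → ¬ SortsBefore g p j
  ¬sortsBefore-max j<n (inj₁ (_ , inj₁ gp<gj)) = ¬max<g j<n gp<gj
  ¬sortsBefore-max j<n (inj₁ (_ , inj₂ (k , _ , k<j , gp<gk))) = ¬max<g (<-trans k<j j<n) gp<gk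
  ¬sortsBefore-max j<n (inj₂ (_ , gp<gj , _)) = ¬max<g j<n gp<gj

  ¬sortsBefore-across-max : ∀ {i j} → j < p → p < i → ¬ SortsBefore g i j
  ¬sortsBefore-across-max j<p p<i (inj₁ (i<j , _)) = <-asym i<j (<-trans j<p p<i)
  ¬sortsBefore-across-max j<p p<i (inj₂ (_ , _ , none)) =
    none (p , j<p , p<i , g<gp (<-trans j<p (m≤m+n (suc p) b)) (<⇒≢ j<p))

  ∈-right : ∀ {k} → k < suc p + b → p < k → g k ∈ right
  ∈-right k<n p<k with k′ , refl ← m≤n⇒∃[o]m+o≡n p<k =
    ∈-stackSortWord-applyUpTo g′ (+-cancelˡ-< (suc p) _ _ k<n)

  sortsBefore⇒precedesIn-around-max :
    (∀ {i j} → i < p → j < p → SortsBefore g i j → PrecedesIn (g i) (g j) left) →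
    (∀ {i j} → i < b → j < b → SortsBefore g′ i j → PrecedesIn (g′ i) (g′ j) right) →
    ∀ {i j} → i < suc p + b → j < suc p + b → SortsBefore g i j →
    PrecedesIn (g i) (g j) (left ++ right ++ [ g p ])
  sortsBefore⇒precedesIn-around-max ih-left ih-right {i} {j} i<n j<n before
    with <-cmp i p | <-cmp j p
  ... | tri< i<p _ _ | tri< j<p _ _ = PrecedesIn-++ʳ (right ++ [ g p ]) (ih-left i<p j<p before)
  ... | tri< i<p _ _ | tri≈ _ refl _ =
    PrecedesIn-∈-++ (∈-stackSortWord-applyUpTo g i<p) (∈-++⁺ʳ right (here refl))
  ... | tri< i<p _ _ | tri> _ _ p<j =
    PrecedesIn-∈-++ (∈-stackSortWord-applyUpTo g i<p) (∈-++⁺ˡ (∈-right j<n p<j))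
  ... | tri≈ _ refl _ | _ = ⊥-elim (¬sortsBefore-max j<n before)
  ... | tri> _ _ p<i | tri< j<p _ _ = ⊥-elim (¬sortsBefore-across-max j<p p<i before)
  ... | tri> _ _ p<i | tri≈ _ refl _ =
    subst (PrecedesIn (g i) (g p)) (++-assoc left right [ g p ])
      (PrecedesIn-∈-++ (∈-++⁺ʳ left (∈-right i<n p<i)) (here refl))
  ... | tri> _ _ p<i | tri> _ _ p<j
    with i′ , refl ← m≤n⇒∃[o]m+o≡n p<i | j′ , refl ← m≤n⇒∃[o]m+o≡n p<j =
    PrecedesIn-++ˡ left (PrecedesIn-++ʳ [ g p ]
      (ih-right (+-cancelˡ-< (suc p) _ _ i<n) (+-cancelˡ-< (suc p) _ _ j<n)
                (sortsBefore-shift g (suc p) before)))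

sortsBefore⇒precedesIn : ∀ {g} → Injective _≡_ _≡_ g → ∀ {n i j} → i < n → j < n →
  SortsBefore g i j → PrecedesIn (g i) (g j) (stackSortWord (applyUpTo g n))
sortsBefore⇒precedesIn g-inj = go (<-wellFounded _) g-inj
  where
  go : ∀ {n} → Acc _<_ n → ∀ {g} → Injective _≡_ _≡_ g → ∀ {i j} → i < n → j < n →
    SortsBefore g i j → PrecedesIn (g i) (g j) (stackSortWord (applyUpTo g n))
  go (acc rec) {g} g-inj {i} {j} i<n j<n before
    with p , p<n , g<gp ← ∃-strict-argmax g-inj (<-≤-trans z<s i<n)
    with b , refl ← m≤n⇒∃[o]m+o≡n p<n =
    subst (PrecedesIn (g i) (g j)) (sym (stackSortWord-applyUpTo-max g p b g<gp))
      (sortsBefore⇒precedesIn-around-max g<gp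
        (go (rec (m≤m+n (suc p) b)) g-inj)
        (go (rec (m<n+m b z<s)) (λ e → +-cancelˡ-≡ (suc p) _ _ (g-inj e)))
        i<n j<n before)

Unique-stackSortWord-applyUpTo : ∀ {g} → Injective _≡_ _≡_ g → ∀ n →
  Unique (stackSortWord (applyUpTo g n))
Unique-stackSortWord-applyUpTo {g} g-inj n =
  PermutationS.Unique-resp-↭ (setoid ℕ) (↭⇒↭ₛ (↭-sym (stackSortWord-↭ _)))
    (UniqueS.applyUpTo⁺₁ (setoid ℕ) g n (λ i<j _ → <⇒≢ i<j ∘ g-inj))

sortsBefore⇔precedesIn : ∀ {g} → Injective _≡_ _≡_ g → ∀ {n i j} → i < n → j < n →
  SortsBefore g i j ⇔ PrecedesIn (g i) (g j) (stackSortWord (applyUpTo g n))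
sortsBefore⇔precedesIn {g} g-inj {n} {i} {j} i<n j<n =
  mk⇔ (sortsBefore⇒precedesIn g-inj i<n j<n) precedesIn⇒sortsBefore
  where
  unique = Unique-stackSortWord-applyUpTo g-inj n
  precedesIn⇒sortsBefore : PrecedesIn (g i) (g j) (stackSortWord (applyUpTo g n)) → SortsBefore g i j
  precedesIn⇒sortsBefore prec with i ≟ j
  ... | yes refl = ⊥-elim (PrecedesIn-asym unique prec prec)
  ... | no i≢j with sortsBefore-connex g-inj i≢j
  ...   | inj₁ before = before
  ...   | inj₂ after = ⊥-elim (PrecedesIn-asym unique prec (sortsBefore⇒precedesIn g-inj j<n i<n after))

tabulate-toℕ : ∀ {A : Set} n (g : ℕ → A) → tabulate {n = n} (g ∘ toℕ) ≡ applyUpTo g n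
tabulate-toℕ zero g = refl
tabulate-toℕ (suc n) g = cong (g 0 ∷_) (tabulate-toℕ n (g ∘ suc))

∃-ℕ⇔∃-Fin : ∀ {n} {P : ℕ → Set} → (∀ {k} → P k → k < n) → (∃[ k ] P k) ⇔ (∃[ c ] P (toℕ c))
∃-ℕ⇔∃-Fin {P = P} bound = mk⇔
  (λ (k , pk) → fromℕ< (bound pk) , subst P (sym (toℕ-fromℕ< (bound pk))) pk)
  (λ (c , pc) → toℕ c , pc)

≡⇒⇔ : ∀ {A B : Set} → A ≡ B → A ⇔ B
≡⇒⇔ = IsEquivalence.reflexive ⇔-isEquivalence

x y : Fin 2
x = zero
y = suc zero

z x′ y′ : Fin 3
z = zero
x′ = suc x
y′ = suc y

sortsBeforeᶠ : Formula 2
sortsBeforeᶠ =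
    ((x <P y) ∧ᶠ ((x <V y) ∨ᶠ ∃ᶠ ((x′ <P z) ∧ᶠ ((z <P y′) ∧ᶠ (x′ <V z)))))
  ∨ᶠ ((y <P x) ∧ᶠ ((x <V y) ∧ᶠ (¬ᶠ ∃ᶠ ((y′ <P z) ∧ᶠ ((z <P x′) ∧ᶠ (y′ <V z))))))

module _ {n : ℕ} (σ : Permutation′ n) where

  -- σ continued by the identity beyond n, which keeps it injective on all of ℕ.
  extend : ℕ → ℕ
  extend k with k <? n
  ... | yes k<n = toℕ (σ ⟨$⟩ʳ fromℕ< k<n)
  ... | no _ = k

  extend-toℕ : ∀ i → extend (toℕ i) ≡ toℕ (σ ⟨$⟩ʳ i)
  extend-toℕ i with toℕ i <? n
  ... | yes i<n = cong (λ c → toℕ (σ ⟨$⟩ʳ c)) (fromℕ<-toℕ i i<n)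
  ... | no i≮n = ⊥-elim (i≮n (toℕ<n i))

  extend-injective : Injective _≡_ _≡_ extend
  extend-injective {k} {l} eq with k <? n | l <? n
  ... | yes k<n | yes l<n =
    trans (sym (toℕ-fromℕ< k<n))
      (trans (cong toℕ (Injection.injective (↔⇒↣ σ) (toℕ-injective eq))) (toℕ-fromℕ< l<n))
  ... | yes _ | no l≮n = ⊥-elim (l≮n (subst (_< n) eq (toℕ<n _)))
  ... | no k≮n | yes _ = ⊥-elim (k≮n (subst (_< n) (sym eq) (toℕ<n _)))
  ... | no _ | no _ = eq

  oneLine-applyUpTo : oneLine σ ≡ applyUpTo extend n
  oneLine-applyUpTo = trans (tabulate-cong (sym ∘ extend-toℕ)) (tabulate-toℕ n extend)

  precedesIn⇔precedesInS : ∀ a b →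
    PrecedesIn (extend (toℕ a)) (extend (toℕ b)) (stackSortWord (applyUpTo extend n)) ⇔ PrecedesInS σ a b
  precedesIn⇔precedesInS a b = ≡⇒⇔ (trans
    (cong₂ (λ u v → PrecedesIn u v (stackSortWord (applyUpTo extend n))) (extend-toℕ a) (extend-toℕ b))
    (cong (PrecedesIn (toℕ (σ ⟨$⟩ʳ a)) (toℕ (σ ⟨$⟩ʳ b)) ∘ stackSortWord) (sym oneLine-applyUpTo)))

  <-extend⇔ : ∀ a c → extend (toℕ a) < extend (toℕ c) ⇔ toℕ (σ ⟨$⟩ʳ a) < toℕ (σ ⟨$⟩ʳ c)
  <-extend⇔ a c = ≡⇒⇔ (cong₂ _<_ (extend-toℕ a) (extend-toℕ c))

  ∃-between⇔ : ∀ a {j} → j ≤ n →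
    (∃[ k ] (toℕ a < k × k < j × extend (toℕ a) < extend k))
      ⇔ (∃[ c ] (toℕ a < toℕ c × toℕ c < j × toℕ (σ ⟨$⟩ʳ a) < toℕ (σ ⟨$⟩ʳ c)))
  ∃-between⇔ a j≤n = ⇔-trans (∃-ℕ⇔∃-Fin (λ (_ , k<j , _) → <-≤-trans k<j j≤n)) (mk⇔
    (λ (c , a<c , c<j , lt) → c , a<c , c<j , Equivalence.to (<-extend⇔ a c) lt)
    (λ (c , a<c , c<j , lt) → c , a<c , c<j , Equivalence.from (<-extend⇔ a c) lt))

  sat⇔sortsBefore : ∀ a b → Sat σ sortsBeforeᶠ (env₂ a b) ⇔ SortsBefore extend (toℕ a) (toℕ b)
  sat⇔sortsBefore a b = mk⇔ to from
    where
    module V = Equivalence (<-extend⇔ a b)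
    module A = Equivalence (∃-between⇔ a (<⇒≤ (toℕ<n b)))
    module B = Equivalence (∃-between⇔ b (<⇒≤ (toℕ<n a)))
    to : Sat σ sortsBeforeᶠ (env₂ a b) → SortsBefore extend (toℕ a) (toℕ b)
    to (inj₁ (a<b , inj₁ lt)) = inj₁ (a<b , inj₁ (V.from lt))
    to (inj₁ (a<b , inj₂ between)) = inj₁ (a<b , inj₂ (A.from between))
    to (inj₂ (b<a , lt , none)) = inj₂ (b<a , V.from lt , none ∘ B.to)
    from : SortsBefore extend (toℕ a) (toℕ b) → Sat σ sortsBeforeᶠ (env₂ a b)
    from (inj₁ (a<b , inj₁ lt)) = inj₁ (a<b , inj₁ (V.to lt))
    from (inj₁ (a<b , inj₂ between)) = inj₁ (a<b , inj₂ (A.to between))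
    from (inj₂ (b<a , lt , none)) = inj₂ (b<a , V.to lt , none ∘ B.from)

proposition3p14 : Σ (Formula 2) λ φ →
    (n : ℕ) (σ : Permutation′ n) (a b : Fin n) →
      Sat σ φ (env₂ a b) ⇔ PrecedesInS σ a b
proposition3p14 = sortsBeforeᶠ , λ n σ a b →
  ⇔-trans (sat⇔sortsBefore σ a b)
    (⇔-trans (sortsBefore⇔precedesIn (extend-injective σ) (toℕ<n a) (toℕ<n b))
             (precedesIn⇔precedesInS σ a b))
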